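{- Let $G$ be a sudoku solution grid and let $U\subseteq G$ be a minimal unavoidable set. If $H\neq G$ is any other completion of $G\setminus U$, then $G$ and $H$ differ in exactly the cells contained in $U$. In particular, every digit appearing in $U$ occurs (in $U$) at least twice.
   Context: A sudoku solution grid is regarded as a function $\{0,\dots,80\}\to\{1,\dots,9\}$ (cells numbered left-to-right, top-to-bottom) satisfying the sudoku rules (each row, column and $3\times3$ box contains each digit exactly once), identified with its graph, a subset of $\{0,\dots,80\}\times\{1,\dots,9\}$. A completion of a subset $X\subseteq G$ is a sudoku solution grid containing $X$. A subset $X\subseteq G$ is unavoidable if $G\setminus X$ has more than one completion; it is minimal if no proper subset of it is unavoidable. A digit $d$ appears in $X$ if $(c,d)\in X$ for some cell $c$; a cell $c$ is contained in $X$ if $(c,d)\in X$ for some $d$. -}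

module Defs where

open import Data.Nat using (ℕ; _/_; _%_; _*_; _+_)
open import Data.Fin using (Fin; toℕ)
open import Data.Bool using (Bool; true)
open import Data.Product using (_×_; Σ; ∃; ∃-syntax; ∃!)
open import Relation.Nullary using (¬_)
open import Relation.Binary.PropositionalEquality using (_≡_; _≢_)

-- Cells 0..80 (numbered left-to-right, top-to-bottom).
Cell : Set
Cell = Fin 81

-- Digits 1..9, represented by Fin 9 (k : Fin 9 stands for digit k+1).
Digit : Set
Digit = Fin 9

Grid : Set
Grid = Cell → Digit

rowOf colOf boxOf : Cell → ℕ
rowOf c = toℕ c / 9
colOf c = toℕ c % 9
boxOf c = (rowOf c / 3) * 3 + colOf c / 3

IsSudoku : Grid → Set
IsSudoku g =
  (∀ (i : Fin 9) (d : Digit) → ∃! _≡_ (λ c → rowOf c ≡ toℕ i × g c ≡ d)) ×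
  (∀ (i : Fin 9) (d : Digit) → ∃! _≡_ (λ c → colOf c ≡ toℕ i × g c ≡ d)) ×
  (∀ (i : Fin 9) (d : Digit) → ∃! _≡_ (λ c → boxOf c ≡ toℕ i × g c ≡ d))

-- Subsets of {0..80} × {1..9}, as (decidable) Bool-valued characteristic functions.
CDSet : Set
CDSet = Cell → Digit → Bool

_∈ₛ_ : Cell × Digit → CDSet → Set
_∈ₛ_ (Data.Product._,_ c d) X = X c d ≡ true

_⊆ₛ_ : CDSet → CDSet → Set
X ⊆ₛ Y = ∀ c d → X c d ≡ true → Y c d ≡ true

_⊆graph_ : CDSet → Grid → Set
X ⊆graph g = ∀ c d → X c d ≡ true → g c ≡ d

_≠grid_ : Grid → Grid → Set
g ≠grid h = ∃[ c ] (g c ≢ h c)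

IsCompletion : CDSet → Grid → Set
IsCompletion X h = IsSudoku h × X ⊆graph h

minusGraph : Grid → CDSet → CDSet
minusGraph g X c d with Data.Fin._≟_ (g c) d
... | Relation.Nullary.yes _ = Data.Bool.not (X c d)
... | Relation.Nullary.no _ = Data.Bool.false

Unavoidable : Grid → CDSet → Set
Unavoidable g X =
  X ⊆graph g ×
  ∃[ h₁ ] ∃[ h₂ ] (IsCompletion (minusGraph g X) h₁ × IsCompletion (minusGraph g X) h₂ × h₁ ≠grid h₂)

MinimalUnavoidable : Grid → CDSet → Set
MinimalUnavoidable g U =
  Unavoidable g U ×
  (∀ (Y : CDSet) → Y ⊆ₛ U → ¬ (U ⊆ₛ Y) → ¬ Unavoidable g Y)

CellIn : Cell → CDSet → Set
CellIn c X = ∃[ d ] (X c d ≡ true)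

DigitIn : Digit → CDSet → Set
DigitIn d X = ∃[ c ] (X c d ≡ true)

module Submission where

-- Outside U the
--     grid H must agree with G, since it contains G ∖ U.  Conversely, let Y be
--     U restricted to the cells where G and H differ.  H still completes G ∖ Y,
--     so Y is unavoidable; by minimality Y cannot be a proper subset of U,
--     hence every cell of U is a cell where G and H differ.
--
-- (2) A rectangle argument for any two sudoku grids G, H: if G c = d ≠ H c,
--     then there is another cell e with G e = d ≠ H e.  Take c' in the row of c
--     with H c' = d, and e in the column of c' with G e = d; if H e = d, then
--     e = c' by the column rule for H and c' = c by the row rule for G.
--     By (1) such a cell e lies in U, and since U ⊆ G it carries digit d.

open import Defs
open import Data.Product using (_×_; ∃-syntax)
open import Data.Bool using (true)
open import Function.Bundles using (_⇔_)
open import Relation.Binary.PropositionalEquality using (_≡_; _≢_)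

open import Data.Product using (∃!; _,_; proj₁; proj₂)
open import Data.Bool using (false; not; _∧_)
open import Data.Nat using (ℕ; _<_; _+_; _*_)
open import Data.Nat.DivMod using (m≡m%n+[m/n]*n; m%n<n; m<n*o⇒m/o<n)
open import Data.Fin using (Fin; toℕ; fromℕ<; _≟_)
open import Data.Fin.Properties using (toℕ<n; toℕ-fromℕ<; toℕ-injective)
open import Data.Empty using (⊥-elim)
open import Relation.Nullary using (¬_; yes; no)
open import Relation.Nullary.Decidable using (⌊_⌋)
open import Relation.Binary.PropositionalEquality using (refl; sym; trans; cong; cong₂; subst; module ≡-Reasoning)
open import Function.Bundles using (mk⇔)

∃!-unique : ∀ {A : Set} {P : A → Set} → ∃! _≡_ P → ∀ {x y} → P x → P y → x ≡ y
∃!-unique (_ , _ , unique) px py = trans (sym (unique px)) (unique py)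

LatinAlong : (Cell → ℕ) → Grid → Set
LatinAlong f g = ∀ (i : Fin 9) (d : Digit) → ∃! _≡_ (λ c → f c ≡ toℕ i × g c ≡ d)

rowOf<9 : ∀ c → rowOf c < 9
rowOf<9 c = m<n*o⇒m/o<n {toℕ c} {9} {9} (toℕ<n c)

colOf<9 : ∀ c → colOf c < 9
colOf<9 c = m%n<n (toℕ c) 9

module Line (f : Cell → ℕ) (f<9 : ∀ c → f c < 9) {g : Grid} (latin : LatinAlong f g) where

  lineIndex : ∀ c → Fin 9
  lineIndex c = fromℕ< (f<9 c)

  lineIndex-correct : ∀ c → toℕ (lineIndex c) ≡ f c
  lineIndex-correct c = toℕ-fromℕ< (f<9 c)

  digitOnLine : ∀ c d → ∃[ c' ] (f c' ≡ f c × g c' ≡ d)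
  digitOnLine c d with latin (lineIndex c) d
  ... | c' , (onLine , gc') , _ = c' , trans onLine (lineIndex-correct c) , gc'

  lineUnique : ∀ {a b} → f a ≡ f b → g a ≡ g b → a ≡ b
  lineUnique {a} {b} sameLine sameDigit =
    ∃!-unique (latin (lineIndex b) (g b))
      (trans sameLine (sym (lineIndex-correct b)) , sameDigit)
      (sym (lineIndex-correct b) , refl)

module Rows {g : Grid} (sg : IsSudoku g) = Line rowOf rowOf<9 (proj₁ sg)
module Cols {g : Grid} (sg : IsSudoku g) = Line colOf colOf<9 (proj₁ (proj₂ sg))

cell-ext : ∀ {a b} → rowOf a ≡ rowOf b → colOf a ≡ colOf b → a ≡ b
cell-ext {a} {b} sameRow sameCol = toℕ-injective (begin
  toℕ a                     ≡⟨ m≡m%n+[m/n]*n (toℕ a) 9 ⟩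
  colOf a + rowOf a * 9     ≡⟨ cong₂ (λ k r → k + r * 9) sameCol sameRow ⟩
  colOf b + rowOf b * 9     ≡⟨ sym (m≡m%n+[m/n]*n (toℕ b) 9) ⟩
  toℕ b                     ∎)
  where open ≡-Reasoning

minusGraph-intro : ∀ {g X c d} → g c ≡ d → X c d ≡ false → minusGraph g X c d ≡ true
minusGraph-intro {g} {X} {c} {d} gc notInX with g c ≟ d
... | yes _ rewrite notInX = refl
... | no gc≢d = ⊥-elim (gc≢d gc)

minusGraph-elim : ∀ {g X c d} → minusGraph g X c d ≡ true → g c ≡ d × X c d ≡ false
minusGraph-elim {g} {X} {c} {d} member with g c ≟ d
... | no _ with () ← member
... | yes gc with X c d
...   | false = gc , refl
...   | true with () ← member

minusGraph⊆graph : ∀ g X → minusGraph g X ⊆graph g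
minusGraph⊆graph g X c d member = proj₁ (minusGraph-elim {g} {X} member)

agreeOutside : ∀ {G X H c} → IsCompletion (minusGraph G X) H → X c (G c) ≡ false → H c ≡ G c
agreeOutside {G} (_ , H⊇) notInX = H⊇ _ _ (minusGraph-intro {G} refl notInX)

differ⇒cellIn : ∀ {G X H} → IsCompletion (minusGraph G X) H → ∀ c → G c ≢ H c → CellIn c X
differ⇒cellIn {G} {X} complete c differ with X c (G c) in inX
... | true  = G c , inX
... | false = ⊥-elim (differ (sym (agreeOutside {G} complete inX)))

restrictToDiff : CDSet → Grid → Grid → CDSet
restrictToDiff X g h c d = X c d ∧ not ⌊ g c ≟ h c ⌋

restrict⊆ : ∀ X g h → restrictToDiff X g h ⊆ₛ X
restrict⊆ X g h c d member with X c d
... | true = refl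

restrict-differs : ∀ {X g h c d} → restrictToDiff X g h c d ≡ true → g c ≢ h c
restrict-differs {X} {g} {h} {c} {d} member with X c d | g c ≟ h c
restrict-differs () | true | yes _
... | true | no gc≢hc = gc≢hc

restrict-agrees : ∀ {X g h c d} → X c d ≡ true → restrictToDiff X g h c d ≡ false → g c ≡ h c
restrict-agrees {X} {g} {h} {c} {d} inX notInRestr with X c d | g c ≟ h c
... | true | yes gc≡hc = gc≡hc
restrict-agrees _ () | true | no _

completesRestriction : ∀ {G X H} → IsCompletion (minusGraph G X) H →
  IsCompletion (minusGraph G (restrictToDiff X G H)) H
completesRestriction {G} {X} {H} (sH , H⊇) = sH , H⊇Y
  where
  H⊇Y : minusGraph G (restrictToDiff X G H) ⊆graph H
  H⊇Y c d member with minusGraph-elim {G} {restrictToDiff X G H} member | X c d in inX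
  ... | gc , _        | false = H⊇ c d (minusGraph-intro {G} gc inX)
  ... | gc , notInY   | true  = trans (sym (restrict-agrees {X} {G} {H} inX notInY)) gc

restrictionUnavoidable : ∀ {G X H} → IsSudoku G → X ⊆graph G →
  IsCompletion (minusGraph G X) H → H ≠grid G → Unavoidable G (restrictToDiff X G H)
restrictionUnavoidable {G} {X} {H} sG X⊆G complete (c , Hc≢Gc) =
  (λ c d member → X⊆G c d (restrict⊆ X G H c d member)) ,
  G , H , (sG , minusGraph⊆graph G _) , completesRestriction {G} complete ,
  (c , λ Gc≡Hc → Hc≢Gc (sym Gc≡Hc))

cellIn⇒differ : ∀ {G U H} → IsSudoku G → MinimalUnavoidable G U →
  IsCompletion (minusGraph G U) H → H ≠grid G → ∀ c → CellIn c U → G c ≢ H c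
cellIn⇒differ {G} {U} {H} sG ((U⊆G , _) , minimal) complete H≠G c (d , inU) Gc≡Hc =
  minimal Y (restrict⊆ U G H) U⊈Y (restrictionUnavoidable sG U⊆G complete H≠G)
  where
  Y : CDSet
  Y = restrictToDiff U G H
  U⊈Y : ¬ (U ⊆ₛ Y)
  U⊈Y U⊆Y = restrict-differs {U} {G} {H} (U⊆Y c d inU) Gc≡Hc

secondDisagreement : ∀ {G H} → IsSudoku G → IsSudoku H → ∀ {c d} → G c ≡ d → H c ≢ d →
  ∃[ e ] (e ≢ c × G e ≡ d × H e ≢ d)
secondDisagreement {G} {H} sG sH {c} {d} Gc Hc≢d with Rows.digitOnLine sH c d
... | c' , c'RowC , Hc' with Cols.digitOnLine sG c' d
... | e , eColC' , Ge = e , e≢c , Ge , He≢d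
  where
  c'≢c : c' ≢ c
  c'≢c c'≡c = Hc≢d (subst (λ x → H x ≡ d) c'≡c Hc')

  e≢c : e ≢ c
  e≢c e≡c = c'≢c (cell-ext c'RowC (trans (sym eColC') (cong colOf e≡c)))

  He≢d : H e ≢ d
  He≢d He = c'≢c (Rows.lineUnique sG c'RowC (trans Gc' (sym Gc)))
    where
    Gc' : G c' ≡ d
    Gc' = subst (λ x → G x ≡ d) (Cols.lineUnique sH eColC' (trans He (sym Hc'))) Ge

mainTheorem4 : (G : Grid) → IsSudoku G → (U : CDSet) → MinimalUnavoidable G U →
    (H : Grid) → IsCompletion (minusGraph G U) H → H ≠grid G →
    (∀ (c : Cell) → (G c ≢ H c) ⇔ CellIn c U) ×
    (∀ (d : Digit) → DigitIn d U → ∃[ c₁ ] ∃[ c₂ ] (c₁ ≢ c₂ × U c₁ d ≡ true × U c₂ d ≡ true))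
mainTheorem4 G sG U minU@((U⊆G , _) , _) H complete@(sH , _) H≠G = differOnU , digitTwice
  where
  differOnU : ∀ c → (G c ≢ H c) ⇔ CellIn c U
  differOnU c = mk⇔ (differ⇒cellIn {G} complete c) (cellIn⇒differ sG minU complete H≠G c)

  digitTwice : ∀ d → DigitIn d U → ∃[ c₁ ] ∃[ c₂ ] (c₁ ≢ c₂ × U c₁ d ≡ true × U c₂ d ≡ true)
  digitTwice d (c , inU) with secondDisagreement sG sH (U⊆G c d inU) Hc≢d
    where
    Hc≢d : H c ≢ d
    Hc≢d Hc = cellIn⇒differ sG minU complete H≠G c (d , inU) (trans (U⊆G c d inU) (sym Hc))
  ... | e , e≢c , Ge , He≢d with differ⇒cellIn {G} complete e (λ Ge≡He → He≢d (trans (sym Ge≡He) Ge))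
  ... | d' , inU' = c , e , (λ c≡e → e≢c (sym c≡e)) , inU ,
                    subst (λ x → U e x ≡ true) (trans (sym (U⊆G e d' inU')) Ge) inU'
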